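{- Let $H_n$ be a connected $3$-graph on $n$ vertices. Then $|E(H_n)|\ge \left\lfloor \frac{1}{2}\binom{n}{2}\right\rfloor$. Moreover, for every $n$ this bound is attained, i.e. there is a connected $3$-graph on $n$ vertices with exactly $\left\lfloor \frac{1}{2}\binom{n}{2}\right\rfloor$ edges.
   Context: A strong path in a $3$-uniform hypergraph ($3$-graph) is a sequence of edges $E_1,\dots,E_m$ with $|E_j\cap E_{j+1}|=2$ for all $j$. A $3$-graph $H$ on vertex set $V$ is connected if for any two distinct $2$-subsets $\{u,v\},\{u',v'\}$ of $V$ there is a strong path $E_1,\dots,E_m$ in $H$ with $\{u,v\}\subset E_1$ and $\{u',v'\}\subset E_m$. -}

module Defs where

open import Data.Nat using (ℕ; _/_)
open import Data.Nat.Combinatorics using (_C_)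
open import Data.Fin.Subset using (Subset; _∩_; ∣_∣; _⊆_)
open import Data.List using (List; length)
open import Data.List.Membership.Propositional using (_∈_)
open import Data.List.Relation.Unary.All using (All)
open import Data.List.Relation.Unary.Unique.Propositional using (Unique)
open import Data.Product using (_×_; ∃₂)
open import Relation.Binary.PropositionalEquality using (_≡_; _≢_)

record ThreeGraph (n : ℕ) : Set where
  constructor mk3
  field
    edges      : List (Subset n)
    edges-size : All (λ e → ∣ e ∣ ≡ 3) edges
    edges-uniq : Unique edges

open ThreeGraph public

numEdges : ∀ {n} → ThreeGraph n → ℕ
numEdges H = length (edges H)

data StrongPath {n : ℕ} (H : ThreeGraph n) : Subset n → Subset n → Set where
  single : ∀ {E} → E ∈ edges H → StrongPath H E E
  step   : ∀ {E E' F} → E ∈ edges H → ∣ E ∩ E' ∣ ≡ 2 →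
           StrongPath H E' F → StrongPath H E F

IsPair : ∀ {n} → Subset n → Set
IsPair p = ∣ p ∣ ≡ 2

Connected : ∀ {n} → ThreeGraph n → Set
Connected {n} H =
  (p q : Subset n) → IsPair p → IsPair q → p ≢ q →
  ∃₂ λ E F → StrongPath H E F × p ⊆ E × q ⊆ F

bound : ℕ → ℕ
bound n = (n C 2) / 2

-- Lower bound: grow a set T of edges from a single edge, each time adding an edge that meets one
-- already in T in exactly two vertices.  Of the three pairs of the new edge the shared one is
-- already covered, so T covers at most 2∣T∣ + 1 pairs.  Once T cannot grow it contains every edge
-- reachable by strong paths, and by connectivity these cover all n C 2 pairs; so n C 2 ≤ 2∣E∣ + 1.
--
-- Construction: explicit extremal graphs for 3 ≤ n ≤ 6, and a step from n to n + 4 vertices adding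
-- 2n + 3 edges: {a, b, x} and {c, d, x} for each old vertex x other than 0 and 1, and seven edges
-- on {a, b, c, d, 0, 1}.  Every edge is chained by shared pairs to an old edge through 0 and 1,
-- which keeps the graph connected.  For n ≤ 2 the empty graph is connected, having no two distinct
-- pairs.

module Submission where

open import Defs
open import Data.Nat using (ℕ; zero; suc; _+_; _*_; _/_; _≤_; _<_; z≤n; s≤s; _≟_)
open import Data.Nat.Properties
open import Data.Nat.Combinatorics using (_C_; nC1≡n; nCk+nC[k+1]≡[n+1]C[k+1])
open import Data.Nat.DivMod using (m<n*o⇒m/o<n; +-distrib-/-∣ʳ; m*n/n≡m)
open import Data.Nat.Divisibility using (n∣m*n)
open import Data.Nat.Tactic.RingSolver using (solve-∀)
open import Data.Bool using (Bool; true; false; not; _∨_) renaming (_≟_ to _≟ᵇ_)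
import Data.Bool as Bool
open import Data.Fin using (Fin; zero; suc; #_)
import Data.Fin.Properties as Fin
open import Data.Fin.Subset using (Subset; ∣_∣; _∩_; _∪_; _⊆_; ⁅_⁆; _∉_; ⊥; ⊤; inside; outside)
  renaming (_∈_ to _∈ˢ_)
open import Data.Fin.Subset.Properties
open import Data.Vec using ([]; _∷_)
import Data.Vec.Base as Vec
open import Data.Vec.Properties using (≡-dec)
open import Data.List using (List; []; _∷_; length; map; _++_; filter; lookup; allFin)
open import Data.List.Properties using (length-++; length-map; length-tabulate; filter-all; filter-++)
open import Data.List.Membership.Propositional using (_∈_; find)
open import Data.List.Membership.Propositional.Properties using (∈-++⁺ˡ; ∈-++⁺ʳ; ∈-map⁺; ∈-allFin; ∈-lookup)
open import Data.List.Relation.Unary.Any using (Any; here; there; index)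
import Data.List.Relation.Unary.Any as Any
open import Data.List.Relation.Unary.Any.Properties using (lookup-index)
open import Data.List.Relation.Unary.All using (All; []; _∷_)
import Data.List.Relation.Unary.All as All
import Data.List.Relation.Unary.All.Properties as All
open import Data.List.Relation.Unary.AllPairs using ([]; _∷_)
import Data.List.Relation.Unary.AllPairs.Properties as AllPairs
open import Data.List.Relation.Unary.Unique.Propositional using (Unique)
import Data.List.Relation.Unary.Unique.Propositional.Properties as Unique
import Data.List.Relation.Unary.Unique.DecPropositional as UniqueDec
open import Data.Product using (_×_; Σ; ∃-syntax; _,_)
open import Data.Sum using (_⊎_; inj₁; inj₂)
open import Function using (_∘_; _∋_; id; case_of_)
open import Relation.Nullary using (¬_; Dec; yes; no; ¬?; contradiction)
open import Relation.Nullary.Decidable using (_×-dec_; True; toWitness)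
open import Relation.Unary using (Pred; Decidable)
open import Relation.Unary.Properties using (_∪?_)
open import Relation.Binary using (Rel)
import Relation.Binary as B
open import Relation.Binary.PropositionalEquality

module _ {a p} {A : Set a} {P : Pred A p} (P? : Decidable P) where

  count : List A → ℕ
  count = length ∘ filter P?

  count-all : ∀ {xs} → All P xs → count xs ≡ length xs
  count-all = cong length ∘ filter-all P?

  count-++ : ∀ xs ys → count (xs ++ ys) ≡ count xs + count ys
  count-++ xs ys = trans (cong length (filter-++ P? xs ys)) (length-++ (filter P? xs))

  count-none : (∀ {x} → ¬ P x) → ∀ xs → count xs ≡ 0
  count-none ¬P [] = refl
  count-none ¬P (x ∷ xs) with P? x
  ... | yes px = contradiction px ¬P
  ... | no _   = count-none ¬P xs

module _ {a b p} {A : Set a} {B : Set b} {P : Pred B p} (P? : Decidable P) (f : A → B) where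

  count-map : ∀ xs → count P? (map f xs) ≡ count (P? ∘ f) xs
  count-map [] = refl
  count-map (x ∷ xs) with P? (f x)
  ... | yes _ = cong suc (count-map xs)
  ... | no  _ = count-map xs

module _ {a p q} {A : Set a} {P : Pred A p} {Q : Pred A q} (P? : Decidable P) (Q? : Decidable Q) where

  count-mono : (∀ {x} → P x → Q x) → ∀ xs → count P? xs ≤ count Q? xs
  count-mono P⇒Q [] = z≤n
  count-mono P⇒Q (x ∷ xs) with P? x | Q? x
  ... | yes _  | yes _  = s≤s (count-mono P⇒Q xs)
  ... | yes px | no ¬qx = contradiction (P⇒Q px) ¬qx
  ... | no _   | yes _  = m≤n⇒m≤1+n (count-mono P⇒Q xs)
  ... | no _   | no _   = count-mono P⇒Q xs

module _ {a p q} {A : Set a} {P : Pred A p} {Q : Pred A q} (P? : Decidable P) (Q? : Decidable Q) where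

  count-cong : (∀ {x} → P x → Q x) → (∀ {x} → Q x → P x) → ∀ xs → count P? xs ≡ count Q? xs
  count-cong P⇒Q Q⇒P xs = ≤-antisym (count-mono P? Q? P⇒Q xs) (count-mono Q? P? Q⇒P xs)

  count-∪ : ∀ {r} {R : Pred A r} (R? : Decidable R) → (∀ {x} → R x → P x) → (∀ {x} → R x → Q x) →
            ∀ xs → count (P? ∪? Q?) xs + count R? xs ≤ count P? xs + count Q? xs
  count-∪ R? R⇒P R⇒Q [] = z≤n
  count-∪ R? R⇒P R⇒Q (x ∷ xs) with P? x | Q? x | R? x | count-∪ R? R⇒P R⇒Q xs
  ... | yes _  | yes _  | yes _  | ih = s≤s (subst₂ _≤_ (sym (+-suc _ _)) (sym (+-suc _ _)) (s≤s ih))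
  ... | yes _  | yes _  | no _   | ih = s≤s (≤-trans ih (+-monoʳ-≤ _ (n≤1+n _)))
  ... | yes _  | no _   | no _   | ih = s≤s ih
  ... | no _   | yes _  | no _   | ih = ≤-trans (s≤s ih) (≤-reflexive (sym (+-suc _ _)))
  ... | no _   | no _   | no _   | ih = ih
  ... | no ¬px | _      | yes rx | _  = contradiction (R⇒P rx) ¬px
  ... | yes _  | no ¬qx | yes rx | _  = contradiction (R⇒Q rx) ¬qx

m≤1+2n⇒m/2≤n : ∀ {m n} → m ≤ 1 + 2 * n → m / 2 ≤ n
m≤1+2n⇒m/2≤n {n = n} m≤ = ≤-pred (m<n*o⇒m/o<n (≤-trans (s≤s m≤) (≤-reflexive (cong (2 +_) (*-comm 2 n)))))

[1+n]C2≡n+nC2 : ∀ n → suc n C 2 ≡ n + n C 2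
[1+n]C2≡n+nC2 n = trans (sym (nCk+nC[k+1]≡[n+1]C[k+1] n 1)) (cong (_+ n C 2) (nC1≡n n))

[2+n]C2≡nC2+[2n+1] : ∀ n → (2 + n) C 2 ≡ n C 2 + (2 * n + 1)
[2+n]C2≡nC2+[2n+1] n = begin
  (2 + n) C 2                 ≡⟨ [1+n]C2≡n+nC2 (1 + n) ⟩
  (1 + n) + (1 + n) C 2       ≡⟨ cong ((1 + n) +_) ([1+n]C2≡n+nC2 n) ⟩
  (1 + n) + (n + n C 2)       ≡⟨ regroup n (n C 2) ⟩
  n C 2 + (2 * n + 1)         ∎
  where
  open ≡-Reasoning
  regroup : ∀ n x → (1 + n) + (n + x) ≡ x + (2 * n + 1)
  regroup = solve-∀

[4+n]C2≡nC2+[2n+3]*2 : ∀ n → (4 + n) C 2 ≡ n C 2 + (2 * n + 3) * 2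
[4+n]C2≡nC2+[2n+3]*2 n = begin
  (4 + n) C 2                              ≡⟨ [2+n]C2≡nC2+[2n+1] (2 + n) ⟩
  (2 + n) C 2 + (2 * (2 + n) + 1)          ≡⟨ cong (_+ (2 * (2 + n) + 1)) ([2+n]C2≡nC2+[2n+1] n) ⟩
  n C 2 + (2 * n + 1) + (2 * (2 + n) + 1)  ≡⟨ regroup n (n C 2) ⟩
  n C 2 + (2 * n + 3) * 2                  ∎
  where
  open ≡-Reasoning
  regroup : ∀ n x → x + (2 * n + 1) + (2 * (2 + n) + 1) ≡ x + (2 * n + 3) * 2
  regroup = solve-∀

bound-+4 : ∀ n → bound (4 + n) ≡ bound n + (2 * n + 3)
bound-+4 n = begin
  bound (4 + n)                   ≡⟨ cong (_/ 2) ([4+n]C2≡nC2+[2n+3]*2 n) ⟩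
  (n C 2 + (2 * n + 3) * 2) / 2   ≡⟨ +-distrib-/-∣ʳ (n C 2) (n∣m*n (2 * n + 3)) ⟩
  bound n + (2 * n + 3) * 2 / 2   ≡⟨ cong (bound n +_) (m*n/n≡m (2 * n + 3) 2) ⟩
  bound n + (2 * n + 3)           ∎
  where open ≡-Reasoning

⊆∧∣p∣≡∣q∣⇒p≡q : ∀ {n} {p q : Subset n} → p ⊆ q → ∣ p ∣ ≡ ∣ q ∣ → p ≡ q
⊆∧∣p∣≡∣q∣⇒p≡q {p = []}         {[]}         _   _  = refl
⊆∧∣p∣≡∣q∣⇒p≡q {p = false ∷ p} {false ∷ q} p⊆q eq = cong (false ∷_) (⊆∧∣p∣≡∣q∣⇒p≡q (drop-∷-⊆ p⊆q) eq)
⊆∧∣p∣≡∣q∣⇒p≡q {p = true ∷ p}  {true ∷ q}  p⊆q eq =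
  cong (true ∷_) (⊆∧∣p∣≡∣q∣⇒p≡q (drop-∷-⊆ p⊆q) (suc-injective eq))
⊆∧∣p∣≡∣q∣⇒p≡q {p = true ∷ p}  {false ∷ q} p⊆q _  with () ← p⊆q Vec.here
⊆∧∣p∣≡∣q∣⇒p≡q {p = false ∷ p} {true ∷ q}  p⊆q eq =
  contradiction eq (<⇒≢ (s≤s (p⊆q⇒∣p∣≤∣q∣ (drop-∷-⊆ p⊆q))))

k≤∣p∩q∣⇒p≡q⊎∣p∩q∣≡k : ∀ {n k} {p q : Subset n} → ∣ p ∣ ≡ suc k → ∣ q ∣ ≡ suc k →
                       k ≤ ∣ p ∩ q ∣ → p ≡ q ⊎ ∣ p ∩ q ∣ ≡ k
k≤∣p∩q∣⇒p≡q⊎∣p∩q∣≡k {p = p} {q} ∣p∣≡1+k ∣q∣≡1+k k≤∣p∩q∣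
  with m≤n⇒m<n∨m≡n (subst (∣ p ∩ q ∣ ≤_) ∣p∣≡1+k (∣p∩q∣≤∣p∣ p q))
... | inj₁ ∣p∩q∣<1+k = inj₂ (≤-antisym (≤-pred ∣p∩q∣<1+k) k≤∣p∩q∣)
... | inj₂ ∣p∩q∣≡1+k = inj₁ (trans (sym (⊆∧∣p∣≡∣q∣⇒p≡q (p∩q⊆p p q) (trans ∣p∩q∣≡1+k (sym ∣p∣≡1+k))))
                                     (⊆∧∣p∣≡∣q∣⇒p≡q (p∩q⊆q p q) (trans ∣p∩q∣≡1+k (sym ∣q∣≡1+k))))

x∉p⇒∣p∣<∣p∪⁅x⁆∣ : ∀ {n} {p : Subset n} {x} → x ∉ p → ∣ p ∣ < ∣ p ∪ ⁅ x ⁆ ∣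
x∉p⇒∣p∣<∣p∪⁅x⁆∣ {x = x} x∉p = p⊂q⇒∣p∣<∣q∣ (p⊆p∪q ⁅ x ⁆ , x , x∈p∪q⁺ (inj₂ (x∈⁅x⁆ x)) , x∉p)

-- At use sites a and b are literals, so the side condition reduces to ⊤ and is found by unification.
∷-⊆ : ∀ {a b n} {p q : Subset n} {a⇒b : Bool.T (not a ∨ b)} → p ⊆ q → a ∷ p ⊆ b ∷ q
∷-⊆ {true}  {true}  p⊆q = in⊆in p⊆q
∷-⊆ {false}         p⊆q = out⊆ p⊆q

∣p∣≡0⇒p≡⊥ : ∀ {n} {p : Subset n} → ∣ p ∣ ≡ 0 → p ≡ ⊥
∣p∣≡0⇒p≡⊥ {p = []}         _  = refl
∣p∣≡0⇒p≡⊥ {p = false ∷ p} eq = cong (false ∷_) (∣p∣≡0⇒p≡⊥ eq)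

∣p∣≡1⇒p≡⁅x⁆ : ∀ {n} {p : Subset n} → ∣ p ∣ ≡ 1 → ∃[ x ] p ≡ ⁅ x ⁆
∣p∣≡1⇒p≡⁅x⁆ {p = true ∷ p}  eq = zero , cong (true ∷_) (∣p∣≡0⇒p≡⊥ (suc-injective eq))
∣p∣≡1⇒p≡⁅x⁆ {p = false ∷ p} eq with ∣p∣≡1⇒p≡⁅x⁆ {p = p} eq
... | x , refl = suc x , refl

p⊆q⇒∣p∩q∣≡∣p∣ : ∀ {n} {p q : Subset n} → p ⊆ q → ∣ p ∩ q ∣ ≡ ∣ p ∣
p⊆q⇒∣p∩q∣≡∣p∣ {p = p} {q} p⊆q = ≤-antisym (∣p∩q∣≤∣p∣ p q) (p⊆q⇒∣p∣≤∣q∣ (λ x∈p → x∈p∩q⁺ (x∈p , p⊆q x∈p)))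

∣p∩⊥∣≡0 : ∀ {n} (p : Subset n) → ∣ p ∩ ⊥ ∣ ≡ 0
∣p∩⊥∣≡0 {n} p = trans (cong ∣_∣ (∩-zeroʳ p)) (∣⊥∣≡0 n)

∷⁴-⊆ : ∀ {a b c d a′ b′ c′ d′ n} {p q : Subset n}
         {a⇒a′ : Bool.T (not a ∨ a′)} {b⇒b′ : Bool.T (not b ∨ b′)}
         {c⇒c′ : Bool.T (not c ∨ c′)} {d⇒d′ : Bool.T (not d ∨ d′)} →
         p ⊆ q → a ∷ b ∷ c ∷ d ∷ p ⊆ a′ ∷ b′ ∷ c′ ∷ d′ ∷ q
∷⁴-⊆ {a⇒a′ = a⇒a′} {b⇒b′} {c⇒c′} {d⇒d′} p⊆q =
  ∷-⊆ {a⇒b = a⇒a′} (∷-⊆ {a⇒b = b⇒b′} (∷-⊆ {a⇒b = c⇒c′} (∷-⊆ {a⇒b = d⇒d′} p⊆q)))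

∷⁴-injectiveʳ : ∀ {a b c d a′ b′ c′ d′ n} {p q : Subset n} →
                (Subset (4 + n) ∋ a ∷ b ∷ c ∷ d ∷ p) ≡ a′ ∷ b′ ∷ c′ ∷ d′ ∷ q → p ≡ q
∷⁴-injectiveʳ refl = refl

⁅⁆-injective : ∀ {n} {x y : Fin n} → ⁅ x ⁆ ≡ ⁅ y ⁆ → x ≡ y
⁅⁆-injective {x = x} {y} eq = x∈⁅y⁆⇒x≡y y (subst (x ∈ˢ_) eq (x∈⁅x⁆ x))

subsets : (k n : ℕ) → List (Subset n)
subsets zero    n       = ⊥ ∷ []
subsets (suc k) zero    = []
subsets (suc k) (suc n) = map (inside ∷_) (subsets k n) ++ map (outside ∷_) (subsets (suc k) n)

subsets-size : ∀ k n → All (λ p → ∣ p ∣ ≡ k) (subsets k n)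
subsets-size zero    n       = ∣⊥∣≡0 n ∷ []
subsets-size (suc k) zero    = []
subsets-size (suc k) (suc n) =
  All.++⁺ (All.map⁺ (All.map (cong suc) (subsets-size k n))) (All.map⁺ (subsets-size (suc k) n))

∈-subsets : ∀ {k n} (p : Subset n) → ∣ p ∣ ≡ k → p ∈ subsets k n
∈-subsets {zero}  []            _  = here refl
∈-subsets {zero}  (outside ∷ p) eq with ∈-subsets p eq
... | here p≡⊥ = here (cong (outside ∷_) p≡⊥)
∈-subsets {suc k} (inside  ∷ p) eq = ∈-++⁺ˡ (∈-map⁺ (inside ∷_) (∈-subsets p (suc-injective eq)))
∈-subsets {suc k} (outside ∷ p) eq = ∈-++⁺ʳ _ (∈-map⁺ (outside ∷_) (∈-subsets p eq))

count-⊆-subsets : ∀ k {n} (S : Subset n) → count (_⊆? S) (subsets k n) ≡ ∣ S ∣ C k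
count-⊆-subsets zero    S = count-all (_⊆? S) (⊥⊆ ∷ [])
count-⊆-subsets (suc k) [] = refl
count-⊆-subsets (suc k) {suc n} (s ∷ S) = begin
  count (_⊆? s ∷ S) (map (inside ∷_) withFirst ++ map (outside ∷_) withoutFirst)
    ≡⟨ count-++ (_⊆? s ∷ S) (map (inside ∷_) withFirst) (map (outside ∷_) withoutFirst) ⟩
  count (_⊆? s ∷ S) (map (inside ∷_) withFirst) + count (_⊆? s ∷ S) (map (outside ∷_) withoutFirst)
    ≡⟨ cong₂ _+_ (count-map (_⊆? s ∷ S) (inside ∷_) withFirst)
                 (count-map (_⊆? s ∷ S) (outside ∷_) withoutFirst) ⟩
  count (λ p → inside ∷ p ⊆? s ∷ S) withFirst + count (λ p → outside ∷ p ⊆? s ∷ S) withoutFirst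
    ≡⟨ cong₂ _+_ (count-withFirst s) count-withoutFirst ⟩
  [ s ]· (∣ S ∣ C k) + ∣ S ∣ C suc k
    ≡⟨ pascal s ⟩
  ∣ s ∷ S ∣ C suc k ∎
  where
  open ≡-Reasoning
  withFirst = subsets k n
  withoutFirst = subsets (suc k) n
  [_]·_ : Bool → ℕ → ℕ
  [ inside  ]· x = x
  [ outside ]· x = 0
  count-withFirst : ∀ s → count (λ p → inside ∷ p ⊆? s ∷ S) withFirst ≡ [ s ]· (∣ S ∣ C k)
  count-withFirst inside  =
    trans (count-cong (λ p → inside ∷ p ⊆? inside ∷ S) (_⊆? S) drop-∷-⊆ in⊆in withFirst)
          (count-⊆-subsets k S)
  count-withFirst outside =
    count-none (λ p → inside ∷ p ⊆? outside ∷ S) (λ p⊆ → case p⊆ Vec.here of λ ()) withFirst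
  count-withoutFirst : count (λ p → outside ∷ p ⊆? s ∷ S) withoutFirst ≡ ∣ S ∣ C suc k
  count-withoutFirst =
    trans (count-cong (λ p → outside ∷ p ⊆? s ∷ S) (_⊆? S) drop-∷-⊆ out⊆ withoutFirst)
          (count-⊆-subsets (suc k) S)
  pascal : ∀ s → [ s ]· (∣ S ∣ C k) + ∣ S ∣ C suc k ≡ ∣ s ∷ S ∣ C suc k
  pascal inside  = nCk+nC[k+1]≡[n+1]C[k+1] ∣ S ∣ k
  pascal outside = refl

length-subsets : ∀ k n → length (subsets k n) ≡ n C k
length-subsets k n = begin
  length (subsets k n)            ≡⟨ sym (count-all (_⊆? ⊤) (All.tabulate {xs = subsets k n} (λ _ → ⊆⊤))) ⟩
  count (_⊆? ⊤) (subsets k n)     ≡⟨ count-⊆-subsets k ⊤ ⟩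
  ∣ ⊤ {n} ∣ C k                   ≡⟨ cong (_C k) (∣⊤∣≡n n) ⟩
  n C k                           ∎
  where open ≡-Reasoning

module Closure {m r} (R : Rel (Fin m) r) (R? : B.Decidable R) where

  Closed : Subset m → Set r
  Closed T = ∀ {i j} → i ∈ˢ T → R i j → j ∈ˢ T

  Boundary : Subset m → Set r
  Boundary T = ∃[ i ] ∃[ j ] i ∈ˢ T × j ∉ T × R i j

  boundary? : ∀ T → Dec (Boundary T)
  boundary? T = Fin.any? λ i → Fin.any? λ j → i ∈? T ×-dec ¬? (j ∈? T) ×-dec R? i j

  ¬Boundary⇒Closed : ∀ {T} → ¬ Boundary T → Closed T
  ¬Boundary⇒Closed {T} ¬b {i} {j} i∈T Rij with j ∈? T
  ... | yes j∈T = j∈T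
  ... | no  j∉T = contradiction (i , j , i∈T , j∉T , Rij) ¬b

  module _ {ℓ} (Inv : Pred (Subset m) ℓ)
           (grow : ∀ {T i j} → i ∈ˢ T → j ∉ T → R i j → Inv T → Inv (T ∪ ⁅ j ⁆)) where

    closure : ∀ {T} → Inv T → ∃[ T′ ] T ⊆ T′ × Inv T′ × Closed T′
    closure {T} = go m (m≤m+n m ∣ T ∣)
      where
      -- Every step adds an element, so m − ∣ T ∣ steps suffice.
      go : ∀ fuel {T} → m ≤ fuel + ∣ T ∣ → Inv T → ∃[ T′ ] T ⊆ T′ × Inv T′ × Closed T′
      go fuel {T} m≤ inv with boundary? T
      ... | no ¬b = T , id , inv , ¬Boundary⇒Closed ¬b
      go zero {T} m≤ inv | yes (_ , j , _ , j∉T , _) =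
        contradiction (≤-trans (∣p∣≤n (T ∪ ⁅ j ⁆)) m≤) (<⇒≱ (x∉p⇒∣p∣<∣p∪⁅x⁆∣ j∉T))
      go (suc fuel) {T} m≤ inv | yes (i , j , i∈T , j∉T , Rij) =
        let T′ , T∪j⊆T′ , inv′ , closed = go fuel m≤′ (grow i∈T j∉T Rij inv)
        in  T′ , T∪j⊆T′ ∘ p⊆p∪q ⁅ j ⁆ , inv′ , closed
        where
        m≤′ : m ≤ fuel + ∣ T ∪ ⁅ j ⁆ ∣
        m≤′ = ≤-trans m≤ (≤-trans (≤-reflexive (sym (+-suc fuel ∣ T ∣)))
                                  (+-monoʳ-≤ fuel (x∉p⇒∣p∣<∣p∪⁅x⁆∣ j∉T)))

module _ {n} {H : ThreeGraph n} where

  head∈ : ∀ {E F} → StrongPath H E F → E ∈ edges H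
  head∈ (single E∈H)   = E∈H
  head∈ (step E∈H _ _) = E∈H

  _++ᵖ_ : ∀ {E F G} → StrongPath H E F → StrongPath H F G → StrongPath H E G
  single _      ++ᵖ q = q
  step E∈ adj p ++ᵖ q = step E∈ adj (p ++ᵖ q)

  reverseᵖ : ∀ {E F} → StrongPath H E F → StrongPath H F E
  reverseᵖ (single E∈)              = single E∈
  reverseᵖ (step {E} {E′} E∈ adj p) =
    reverseᵖ p ++ᵖ step (head∈ p) (trans (cong ∣_∣ (∩-comm E′ E)) adj) (single E∈)

module LowerBound {n} (H : ThreeGraph n) where

  m : ℕ
  m = numEdges H

  edge : Fin m → Subset n
  edge = lookup (edges H)

  edge-size : ∀ i → ∣ edge i ∣ ≡ 3
  edge-size i = All.lookup (edges-size H) (∈-lookup i)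

  indexOf : ∀ {E} → E ∈ edges H → ∃[ i ] edge i ≡ E
  indexOf E∈H = index E∈H , sym (lookup-index E∈H)

  Adjacent : Rel (Fin m) _
  Adjacent i j = ∣ edge i ∩ edge j ∣ ≡ 2

  open Closure Adjacent (λ i j → ∣ edge i ∩ edge j ∣ ≟ 2)

  closed-reach : ∀ {T i F} → Closed T → i ∈ˢ T → StrongPath H (edge i) F → ∃[ j ] j ∈ˢ T × edge j ≡ F
  closed-reach closed i∈T (single _) = _ , i∈T , refl
  closed-reach closed i∈T (step _ adj path) with indexOf (head∈ path)
  ... | j , refl = closed-reach closed (closed i∈T adj) path

  Covered : Subset m → Pred (Subset n) _
  Covered T q = ∃[ k ] k ∈ˢ T × q ⊆ edge k

  covered? : ∀ T q → Dec (Covered T q)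
  covered? T q = Fin.any? λ k → k ∈? T ×-dec q ⊆? edge k

  pairs : List (Subset n)
  pairs = subsets 2 n

  FewCovered : Pred (Subset m) _
  FewCovered T = count (covered? T) pairs ≤ 1 + 2 * ∣ T ∣

  covered-⁅⁆ : ∀ k {q} → Covered ⁅ k ⁆ q → q ⊆ edge k
  covered-⁅⁆ k (k′ , k′∈⁅k⁆ , q⊆) = subst (λ k → _ ⊆ edge k) (x∈⁅y⁆⇒x≡y k k′∈⁅k⁆) q⊆

  count-⊆-edge : ∀ k → count (_⊆? edge k) pairs ≡ 3
  count-⊆-edge k = trans (count-⊆-subsets 2 (edge k)) (cong (_C 2) (edge-size k))

  fewCovered-⁅⁆ : ∀ k → FewCovered ⁅ k ⁆
  fewCovered-⁅⁆ k = begin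
    count (covered? ⁅ k ⁆) pairs ≤⟨ count-mono (covered? ⁅ k ⁆) (_⊆? edge k) (covered-⁅⁆ k) pairs ⟩
    count (_⊆? edge k) pairs     ≡⟨ count-⊆-edge k ⟩
    3                            ≡⟨ cong (λ x → 1 + 2 * x) (∣⁅x⁆∣≡1 k) ⟨
    1 + 2 * ∣ ⁅ k ⁆ ∣            ∎
    where open ≤-Reasoning

  count-covered-∪ : ∀ {T i j} → i ∈ˢ T → Adjacent i j →
                    count (covered? (T ∪ ⁅ j ⁆)) pairs + 1 ≤ count (covered? T) pairs + 3
  count-covered-∪ {T} {i} {j} i∈T adj = begin
    count (covered? (T ∪ ⁅ j ⁆)) pairs + 1
      ≤⟨ +-mono-≤ (count-mono (covered? (T ∪ ⁅ j ⁆)) (covered? T ∪? (_⊆? edge j)) split pairs)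
                  (≤-reflexive (sym count-⊆-shared)) ⟩
    count (covered? T ∪? (_⊆? edge j)) pairs + count (_⊆? shared) pairs
      ≤⟨ count-∪ (covered? T) (_⊆? edge j) (_⊆? shared) ⊆shared⇒covered ⊆shared⇒⊆edge pairs ⟩
    count (covered? T) pairs + count (_⊆? edge j) pairs
      ≡⟨ cong (count (covered? T) pairs +_) (count-⊆-edge j) ⟩
    count (covered? T) pairs + 3 ∎
    where
    open ≤-Reasoning
    shared = edge i ∩ edge j
    count-⊆-shared : count (_⊆? shared) pairs ≡ 1
    count-⊆-shared = trans (count-⊆-subsets 2 shared) (cong (_C 2) adj)
    ⊆shared⇒covered : ∀ {q} → q ⊆ shared → Covered T q
    ⊆shared⇒covered q⊆ = i , i∈T , ⊆-trans q⊆ (p∩q⊆p _ _)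
    ⊆shared⇒⊆edge : ∀ {q} → q ⊆ shared → q ⊆ edge j
    ⊆shared⇒⊆edge q⊆ = ⊆-trans q⊆ (p∩q⊆q _ _)
    split : ∀ {q} → Covered (T ∪ ⁅ j ⁆) q → Covered T q ⊎ q ⊆ edge j
    split (k , k∈T∪j , q⊆) with x∈p∪q⁻ T ⁅ j ⁆ k∈T∪j
    ... | inj₁ k∈T   = inj₁ (k , k∈T , q⊆)
    ... | inj₂ k∈⁅j⁆ = inj₂ (covered-⁅⁆ j (k , k∈⁅j⁆ , q⊆))

  fewCovered-grow : ∀ {T i j} → i ∈ˢ T → j ∉ T → Adjacent i j → FewCovered T → FewCovered (T ∪ ⁅ j ⁆)
  fewCovered-grow {T} {i} {j} i∈T j∉T adj few = begin
    count (covered? (T ∪ ⁅ j ⁆)) pairs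
      ≤⟨ +-cancelʳ-≤ 1 _ _ (≤-trans (count-covered-∪ i∈T adj) (≤-reflexive (sym (+-assoc _ 2 1)))) ⟩
    count (covered? T) pairs + 2 ≤⟨ +-monoˡ-≤ 2 few ⟩
    1 + 2 * ∣ T ∣ + 2           ≡⟨ trans (+-comm _ 2) (cong suc (sym (*-suc 2 ∣ T ∣))) ⟩
    1 + 2 * suc ∣ T ∣           ≤⟨ +-monoʳ-≤ 1 (*-monoʳ-≤ 2 (x∉p⇒∣p∣<∣p∪⁅x⁆∣ j∉T)) ⟩
    1 + 2 * ∣ T ∪ ⁅ j ⁆ ∣        ∎
    where open ≤-Reasoning

  closed-covers : Connected H → ∀ {T i p} → Closed T → i ∈ˢ T → IsPair p → p ⊆ edge i →
                  ∀ q → IsPair q → Covered T q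
  closed-covers connected {T} {i} {p} closed i∈T ∣p∣≡2 p⊆ q ∣q∣≡2 with ≡-dec _≟ᵇ_ p q
  ... | yes refl = i , i∈T , p⊆
  ... | no p≢q with connected p q ∣p∣≡2 ∣q∣≡2 p≢q
  ... | _ , F , path , p⊆E , q⊆F with indexOf (head∈ path)
  ... | k , refl = covered (closed-reach closed i∈T path′)
    where
    2≤∣∩∣ : 2 ≤ ∣ edge i ∩ edge k ∣
    2≤∣∩∣ = subst (_≤ _) ∣p∣≡2 (p⊆q⇒∣p∣≤∣q∣ (λ x∈p → x∈p∩q⁺ (p⊆ x∈p , p⊆E x∈p)))
    path′ : StrongPath H (edge i) F
    path′ with k≤∣p∩q∣⇒p≡q⊎∣p∩q∣≡k (edge-size i) (edge-size k) 2≤∣∩∣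
    ... | inj₁ eq  = subst (λ E → StrongPath H E F) (sym eq) path
    ... | inj₂ adj = step (∈-lookup i) adj path
    covered : ∃[ j ] j ∈ˢ T × edge j ≡ F → Covered T q
    covered (j , j∈T , refl) = j , j∈T , q⊆F

  bound≤numEdges : Connected H → ∀ {p q} → IsPair p → IsPair q → p ≢ q → bound n ≤ m
  bound≤numEdges connected {p} {q} ∣p∣≡2 ∣q∣≡2 p≢q with connected p q ∣p∣≡2 ∣q∣≡2 p≢q
  ... | _ , _ , path , p⊆ , _ with indexOf (head∈ path)
  ... | i , refl with closure FewCovered fewCovered-grow (fewCovered-⁅⁆ i)
  ... | T , ⁅i⁆⊆T , few , closed = m≤1+2n⇒m/2≤n (begin
    n C 2                          ≡⟨ length-subsets 2 n ⟨
    length pairs                   ≡⟨ count-all (covered? T) all-covered ⟨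
    count (covered? T) pairs       ≤⟨ few ⟩
    1 + 2 * ∣ T ∣                  ≤⟨ +-monoʳ-≤ 1 (*-monoʳ-≤ 2 (∣p∣≤n T)) ⟩
    1 + 2 * m                      ∎)
    where
    open ≤-Reasoning
    all-covered : All (Covered T) pairs
    all-covered =
      All.map (closed-covers connected closed (⁅i⁆⊆T (x∈⁅x⁆ i)) ∣p∣≡2 p⊆ _) (subsets-size 2 n)

lower-bound : ∀ n (H : ThreeGraph n) → Connected H → bound n ≤ numEdges H
lower-bound 0 _ _ = z≤n
lower-bound 1 _ _ = z≤n
lower-bound 2 _ _ = z≤n
lower-bound (suc (suc (suc n))) H connected =
  LowerBound.bound≤numEdges H connected {p₀} {p₁} ∣pᵢ∣≡2 ∣pᵢ∣≡2 (λ ())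
  where
  p₀ p₁ : Subset (3 + n)
  p₀ = true ∷ true  ∷ false ∷ ⊥
  p₁ = true ∷ false ∷ true  ∷ ⊥
  ∣pᵢ∣≡2 : 2 + ∣ ⊥ {n} ∣ ≡ 2
  ∣pᵢ∣≡2 = cong (2 +_) (∣⊥∣≡0 n)

data Linked {n} (r : Subset n) : List (Subset n) → Set where
  base : Linked r (r ∷ [])
  link : ∀ {e e′ es} → e′ ∈ es → ∣ e ∩ e′ ∣ ≡ 2 → Linked r es → Linked r (e ∷ es)

linked-++ : ∀ {n r} xs {ys : List (Subset n)} → All (λ e → ∃[ e′ ] e′ ∈ ys × ∣ e ∩ e′ ∣ ≡ 2) xs →
            Linked r ys → Linked r (xs ++ ys)
linked-++ []       []                        linked = linked
linked-++ (_ ∷ xs) ((_ , e′∈ , adj) ∷ links) linked = link (∈-++⁺ʳ xs e′∈) adj (linked-++ xs links linked)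

linked-map : ∀ {n k r es} (f : Subset n → Subset k) → (∀ e e′ → ∣ f e ∩ f e′ ∣ ≡ ∣ e ∩ e′ ∣) →
             Linked r es → Linked (f r) (map f es)
linked-map f f-∩ base              = base
linked-map f f-∩ (link e′∈ adj l) = link (∈-map⁺ f e′∈) (trans (f-∩ _ _) adj) (linked-map f f-∩ l)

Covering : ∀ {n} → List (Subset n) → Set
Covering {n} es = ∀ p → IsPair p → ∃[ e ] e ∈ es × p ⊆ e

path-to-root : ∀ {n} {H : ThreeGraph n} {r es E} → Linked r es → (∀ {e} → e ∈ es → e ∈ edges H) → E ∈ es →
               StrongPath H E r
path-to-root base             ⊆H (here refl) = single (⊆H (here refl))
path-to-root (link e′∈ adj l) ⊆H (here refl) = step (⊆H (here refl)) adj (path-to-root l (⊆H ∘ there) e′∈)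
path-to-root (link _ _ l)     ⊆H (there E∈)  = path-to-root l (⊆H ∘ there) E∈

linked-connected : ∀ {n} (H : ThreeGraph n) {r} → Linked r (edges H) → Covering (edges H) → Connected H
linked-connected H linked covering p q ∣p∣≡2 ∣q∣≡2 _ with covering p ∣p∣≡2 | covering q ∣q∣≡2
... | E , E∈ , p⊆E | F , F∈ , q⊆F =
  E , F , path-to-root linked (λ e∈ → e∈) E∈ ++ᵖ reverseᵖ (path-to-root linked (λ e∈ → e∈) F∈) , p⊆E , q⊆F

connected-≤2 : ∀ {n} → n ≤ 2 → (H : ThreeGraph n) → Connected H
connected-≤2 {0} _ _ p _ ∣p∣≡2 = contradiction (subst (_≤ 0) ∣p∣≡2 (∣p∣≤n p)) λ ()
connected-≤2 {1} _ _ p _ ∣p∣≡2 = contradiction (subst (_≤ 1) ∣p∣≡2 (∣p∣≤n p)) λ { (s≤s ()) }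
connected-≤2 {2} _ _ p q ∣p∣≡2 ∣q∣≡2 p≢q =
  contradiction (trans (∣p∣≡n⇒p≡⊤ ∣p∣≡2) (sym (∣p∣≡n⇒p≡⊤ ∣q∣≡2))) p≢q
connected-≤2 {suc (suc (suc _))} (s≤s (s≤s ()))

covering-by-check : ∀ {n} (es : List (Subset n)) → All (λ p → Any (p ⊆_) es) (subsets 2 n) → Covering es
covering-by-check es check p ∣p∣≡2 = find (All.lookup check (∈-subsets p ∣p∣≡2))

record Optimal (n : ℕ) : Set where
  field
    graph    : ThreeGraph n
    {root}   : Subset n
    linked   : Linked root (edges graph)
    covering : Covering (edges graph)
    optimal  : numEdges graph ≡ bound n

triple : ∀ {n} → Fin n → Fin n → Fin n → Subset n
triple i j k = ⁅ i ⁆ ∪ ⁅ j ⁆ ∪ ⁅ k ⁆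

module _ {n} (es : List (Subset n)) where

  sizes? : Dec (All (λ e → ∣ e ∣ ≡ 3) es)
  sizes? = All.all? (λ e → ∣ e ∣ ≟ 3) es

  unique? : Dec (Unique es)
  unique? = UniqueDec.unique? (≡-dec _≟ᵇ_) es

  covering? : Dec (All (λ p → Any (p ⊆_) es) (subsets 2 n))
  covering? = All.all? (λ p → Any.any? (p ⊆?_) es) (subsets 2 n)

optimal-by-check : ∀ {n} (es : List (Subset n)) {r} → Linked r es →
                   {sizes : True (sizes? es)} {uniq : True (unique? es)} {covers : True (covering? es)} →
                   length es ≡ bound n → Optimal n
optimal-by-check es linked {sizes} {uniq} {covers} eq = record
  { graph    = mk3 es (toWitness sizes) (toWitness uniq)
  ; linked   = linked
  ; covering = covering-by-check es (toWitness covers)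
  ; optimal  = eq
  }

optimal₃ : Optimal 3
optimal₃ = optimal-by-check (triple (# 0) (# 1) (# 2) ∷ []) base refl

optimal₄ : Optimal 4
optimal₄ = optimal-by-check
  (triple (# 1) (# 2) (# 3) ∷ triple (# 0) (# 2) (# 3) ∷ triple (# 0) (# 1) (# 2) ∷ [])
  (link (here refl) refl (link (here refl) refl base)) refl

optimal₅ : Optimal 5
optimal₅ = optimal-by-check
  (triple (# 2) (# 3) (# 4) ∷ triple (# 1) (# 2) (# 4) ∷ triple (# 0) (# 3) (# 4) ∷
   triple (# 0) (# 1) (# 3) ∷ triple (# 0) (# 1) (# 2) ∷ [])
  (link (here refl) refl (link (there (there (here refl))) refl
    (link (here refl) refl (link (here refl) refl base)))) refl

optimal₆ : Optimal 6
optimal₆ = optimal-by-check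
  (triple (# 2) (# 3) (# 5) ∷ triple (# 2) (# 4) (# 5) ∷ triple (# 0) (# 1) (# 5) ∷ triple (# 1) (# 3) (# 4) ∷
   triple (# 0) (# 2) (# 4) ∷ triple (# 0) (# 1) (# 3) ∷ triple (# 0) (# 1) (# 2) ∷ [])
  (link (here refl) refl (link (there (there (here refl))) refl (link (there (there (here refl))) refl
    (link (there (here refl)) refl (link (there (here refl)) refl (link (here refl) refl base)))))) refl

-- The extended vertex set lists the new vertices a, b, c, d first and then the N old ones;
-- o₀, o₁ are the old vertices 0 and 1, and w : Fin (suc m) stands for the old vertex w + 2.
module Extension (m : ℕ) where

  N : ℕ
  N = 3 + m

  ws : List (Fin (suc m))
  ws = allFin (suc m)

  o₀ o₁ o₀₁ : Subset N
  o₀  = true  ∷ false ∷ false ∷ ⊥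
  o₁  = false ∷ true  ∷ false ∷ ⊥
  o₀₁ = true  ∷ true  ∷ false ∷ ⊥

  lift : Subset N → Subset (4 + N)
  lift E = false ∷ false ∷ false ∷ false ∷ E

  abx cdx : Fin (suc m) → Subset (4 + N)
  abx w = true  ∷ true  ∷ false ∷ false ∷ ⁅ suc (suc w) ⁆
  cdx w = false ∷ false ∷ true  ∷ true  ∷ ⁅ suc (suc w) ⁆

  ao₀o₁ abo₀ aco₁ ado₀ bco₀ bcd bdo₁ : Subset (4 + N)
  ao₀o₁ = true  ∷ false ∷ false ∷ false ∷ o₀₁
  abo₀  = true  ∷ true  ∷ false ∷ false ∷ o₀
  aco₁  = true  ∷ false ∷ true  ∷ false ∷ o₁
  ado₀  = true  ∷ false ∷ false ∷ true  ∷ o₀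
  bco₀  = false ∷ true  ∷ true  ∷ false ∷ o₀
  bcd   = false ∷ true  ∷ true  ∷ true  ∷ ⊥
  bdo₁  = false ∷ true  ∷ false ∷ true  ∷ o₁

  gadget : List (Subset (4 + N))
  gadget = bdo₁ ∷ bcd ∷ bco₀ ∷ ado₀ ∷ aco₁ ∷ abo₀ ∷ ao₀o₁ ∷ []

  stars : List (Subset (4 + N))
  stars = map abx ws ++ map cdx ws

  extend : List (Subset N) → List (Subset (4 + N))
  extend es = stars ++ gadget ++ map lift es

  extend-sizes : ∀ {es} → All (λ e → ∣ e ∣ ≡ 3) es → All (λ e → ∣ e ∣ ≡ 3) (extend es)
  extend-sizes sizes =
    All.++⁺ {xs = stars}
      (All.++⁺ {xs = map abx ws} (All.map⁺ {f = abx} (All.universal star-size ws))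
                                 (All.map⁺ {f = cdx} (All.universal star-size ws)))
      (All.++⁺ {xs = gadget} (three ∷ three ∷ three ∷ three ∷ three ∷ three ∷ three ∷ [])
                             (All.map⁺ {f = lift} sizes))
    where
    three : 3 + ∣ ⊥ {m} ∣ ≡ 3
    three = cong (3 +_) (∣⊥∣≡0 m)
    star-size : ∀ (w : Fin (suc m)) → 2 + ∣ ⁅ w ⁆ ∣ ≡ 3
    star-size w = cong (2 +_) (∣⁅x⁆∣≡1 w)

  lift-injective : ∀ {E F} → lift E ≡ lift F → E ≡ F
  lift-injective = ∷⁴-injectiveʳ

  star-injective : ∀ {x y : Fin (suc m)} → (Subset N ∋ ⁅ suc (suc x) ⁆) ≡ ⁅ suc (suc y) ⁆ → x ≡ y
  star-injective = Fin.suc-injective ∘ Fin.suc-injective ∘ ⁅⁆-injective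

  ≢-lifts : ∀ {e} es → (∀ {E} → e ≢ lift E) → All (e ≢_) (map lift es)
  ≢-lifts es e≢ = All.map⁺ (All.universal (λ _ → e≢) es)

  extend-unique : ∀ {es} → Unique es → Unique (extend es)
  extend-unique {es} unique =
    AllPairs.++⁺ unique-stars (AllPairs.++⁺ unique-gadget (Unique.map⁺ lift-injective unique) gadget≢lifts)
                 stars≢rest
    where
    unique-stars : Unique stars
    unique-stars =
      AllPairs.++⁺ (Unique.map⁺ (star-injective ∘ ∷⁴-injectiveʳ) (Unique.allFin⁺ (suc m)))
                   (Unique.map⁺ (star-injective ∘ ∷⁴-injectiveʳ) (Unique.allFin⁺ (suc m)))
                   (All.map⁺ (All.universal (λ _ → All.map⁺ (All.universal (λ _ ()) ws)) ws))
    unique-gadget : Unique gadget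
    unique-gadget =
      ((λ ()) ∷ (λ ()) ∷ (λ ()) ∷ (λ ()) ∷ (λ ()) ∷ (λ ()) ∷ []) ∷
      ((λ ()) ∷ (λ ()) ∷ (λ ()) ∷ (λ ()) ∷ (λ ()) ∷ []) ∷
      ((λ ()) ∷ (λ ()) ∷ (λ ()) ∷ (λ ()) ∷ []) ∷
      ((λ ()) ∷ (λ ()) ∷ (λ ()) ∷ []) ∷
      ((λ ()) ∷ (λ ()) ∷ []) ∷
      ((λ ()) ∷ []) ∷ [] ∷ []
    gadget≢lifts : All (λ e → All (e ≢_) (map lift es)) gadget
    gadget≢lifts = ≢-lifts es (λ ()) ∷ ≢-lifts es (λ ()) ∷ ≢-lifts es (λ ()) ∷ ≢-lifts es (λ ()) ∷
                   ≢-lifts es (λ ()) ∷ ≢-lifts es (λ ()) ∷ ≢-lifts es (λ ()) ∷ []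
    star≢rest : ∀ {e} → (∀ {E} → e ≢ lift E) → e ≢ bdo₁ → e ≢ bcd → e ≢ bco₀ → e ≢ ado₀ → e ≢ aco₁ →
                e ≢ abo₀ → e ≢ ao₀o₁ → All (e ≢_) (gadget ++ map lift es)
    star≢rest e≢lift ≢₁ ≢₂ ≢₃ ≢₄ ≢₅ ≢₆ ≢₇ =
      All.++⁺ (≢₁ ∷ ≢₂ ∷ ≢₃ ∷ ≢₄ ∷ ≢₅ ∷ ≢₆ ∷ ≢₇ ∷ []) (≢-lifts es e≢lift)
    stars≢rest : All (λ e → All (e ≢_) (gadget ++ map lift es)) stars
    stars≢rest = All.++⁺ (All.map⁺ (All.universal abx≢rest ws)) (All.map⁺ (All.universal cdx≢rest ws))
      where
      abx≢rest cdx≢rest : ∀ w → All (_ ≢_) (gadget ++ map lift es)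
      abx≢rest w = star≢rest {abx w} (λ ()) (λ ()) (λ ()) (λ ()) (λ ()) (λ ()) (λ ()) (λ ())
      cdx≢rest w = star≢rest {cdx w} (λ ()) (λ ()) (λ ()) (λ ()) (λ ()) (λ ()) (λ ()) (λ ())

  ∣o₀₁∣≡2 : ∣ o₀₁ ∣ ≡ 2
  ∣o₀₁∣≡2 = cong (2 +_) (∣⊥∣≡0 m)

  extend-linked : ∀ {es r} → Covering es → Linked r es → Linked (lift r) (extend es)
  extend-linked {es} covering linked with covering o₀₁ ∣o₀₁∣≡2
  ... | E₀₁ , E₀₁∈ , o₀₁⊆E₀₁ =
    linked-++ stars
      (All.++⁺ (All.map⁺ (All.universal abx-link ws)) (All.map⁺ (All.universal cdx-link ws)))
      (link (here refl) two (link (here refl) two (link (there (there (here refl))) two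
        (link (there (there (here refl))) two (link (there (here refl)) two (link (here refl) two
          (link (∈-map⁺ lift E₀₁∈) (trans (p⊆q⇒∣p∩q∣≡∣p∣ o₀₁⊆E₀₁) ∣o₀₁∣≡2)
            (linked-map lift (λ _ _ → refl) linked))))))))
    where
    in-gadget : ∀ {e} → e ∈ gadget → e ∈ gadget ++ map lift es
    in-gadget = ∈-++⁺ˡ
    abx-link : ∀ w → ∃[ e′ ] e′ ∈ gadget ++ map lift es × ∣ abx w ∩ e′ ∣ ≡ 2
    abx-link w = abo₀ , in-gadget (there (there (there (there (there (here refl)))))) , cong (2 +_) (∣p∩⊥∣≡0 ⁅ w ⁆)
    cdx-link : ∀ w → ∃[ e′ ] e′ ∈ gadget ++ map lift es × ∣ cdx w ∩ e′ ∣ ≡ 2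
    cdx-link w = bcd , in-gadget (there (here refl)) , cong (2 +_) (∣p∩⊥∣≡0 ⁅ w ⁆)
    two : 2 + ∣ ⊥ {m} ∩ ⊥ ∣ ≡ 2
    two = cong (2 +_) (∣p∩⊥∣≡0 (⊥ {m}))

  extend-covering : ∀ {es} → Covering es → Covering (extend es)
  extend-covering {es} covering = cover
    where
    in-gadget : ∀ {e} → e ∈ gadget → e ∈ extend es
    in-gadget = ∈-++⁺ʳ stars ∘ ∈-++⁺ˡ
    bdo₁∈ : bdo₁ ∈ extend es
    bdo₁∈ = in-gadget (here refl)
    bcd∈ : bcd ∈ extend es
    bcd∈ = in-gadget (there (here refl))
    bco₀∈ : bco₀ ∈ extend es
    bco₀∈ = in-gadget (there (there (here refl)))
    ado₀∈ : ado₀ ∈ extend es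
    ado₀∈ = in-gadget (there (there (there (here refl))))
    aco₁∈ : aco₁ ∈ extend es
    aco₁∈ = in-gadget (there (there (there (there (here refl)))))
    abo₀∈ : abo₀ ∈ extend es
    abo₀∈ = in-gadget (there (there (there (there (there (here refl))))))
    ao₀o₁∈ : ao₀o₁ ∈ extend es
    ao₀o₁∈ = in-gadget (there (there (there (there (there (there (here refl)))))))
    abx∈ : ∀ w → abx w ∈ extend es
    abx∈ w = ∈-++⁺ˡ (∈-++⁺ˡ (∈-map⁺ abx (∈-allFin w)))
    cdx∈ : ∀ w → cdx w ∈ extend es
    cdx∈ w = ∈-++⁺ˡ (∈-++⁺ʳ (map abx ws) (∈-map⁺ cdx (∈-allFin w)))
    lift∈ : ∀ {E} → E ∈ es → lift E ∈ extend es
    lift∈ E∈ = ∈-++⁺ʳ stars (∈-++⁺ʳ gadget (∈-map⁺ lift E∈))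
    ∅⊆ : ∀ {X Y : Subset N} → 2 + ∣ X ∣ ≡ 2 → X ⊆ Y
    ∅⊆ eq = subst (_⊆ _) (sym (∣p∣≡0⇒p≡⊥ (suc-injective (suc-injective eq)))) ⊥⊆

    cover : Covering (extend es)
    cover (true  ∷ true  ∷ true  ∷ _     ∷ _) ()
    cover (true  ∷ true  ∷ false ∷ true  ∷ _) ()
    cover (true  ∷ false ∷ true  ∷ true  ∷ _) ()
    cover (false ∷ true  ∷ true  ∷ true  ∷ _) ()
    cover (false ∷ false ∷ false ∷ false ∷ X) ∣X∣≡2 with covering X ∣X∣≡2
    ... | E , E∈ , X⊆E = lift E , lift∈ E∈ , ∷⁴-⊆ X⊆E
    cover (true  ∷ true  ∷ false ∷ false ∷ X) eq = abo₀ , abo₀∈ , ∷⁴-⊆ (∅⊆ eq)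
    cover (true  ∷ false ∷ true  ∷ false ∷ X) eq = aco₁ , aco₁∈ , ∷⁴-⊆ (∅⊆ eq)
    cover (true  ∷ false ∷ false ∷ true  ∷ X) eq = ado₀ , ado₀∈ , ∷⁴-⊆ (∅⊆ eq)
    cover (false ∷ true  ∷ true  ∷ false ∷ X) eq = bco₀ , bco₀∈ , ∷⁴-⊆ (∅⊆ eq)
    cover (false ∷ true  ∷ false ∷ true  ∷ X) eq = bdo₁ , bdo₁∈ , ∷⁴-⊆ (∅⊆ eq)
    cover (false ∷ false ∷ true  ∷ true  ∷ X) eq = bcd  , bcd∈  , ∷⁴-⊆ (∅⊆ eq)
    cover (true  ∷ false ∷ false ∷ false ∷ X) eq with ∣p∣≡1⇒p≡⁅x⁆ {p = X} (suc-injective eq)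
    ... | zero        , refl = ao₀o₁ , ao₀o₁∈ , ∷⁴-⊆ (in⊆in ⊥⊆)
    ... | suc zero    , refl = ao₀o₁ , ao₀o₁∈ , ∷⁴-⊆ (out⊆ (in⊆in ⊥⊆))
    ... | suc (suc w) , refl = abx w , abx∈ w , ∷⁴-⊆ ⊆-refl
    cover (false ∷ true  ∷ false ∷ false ∷ X) eq with ∣p∣≡1⇒p≡⁅x⁆ {p = X} (suc-injective eq)
    ... | zero        , refl = abo₀ , abo₀∈ , ∷⁴-⊆ (in⊆in ⊥⊆)
    ... | suc zero    , refl = bdo₁ , bdo₁∈ , ∷⁴-⊆ (out⊆ (in⊆in ⊥⊆))
    ... | suc (suc w) , refl = abx w , abx∈ w , ∷⁴-⊆ ⊆-refl
    cover (false ∷ false ∷ true  ∷ false ∷ X) eq with ∣p∣≡1⇒p≡⁅x⁆ {p = X} (suc-injective eq)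
    ... | zero        , refl = bco₀ , bco₀∈ , ∷⁴-⊆ (in⊆in ⊥⊆)
    ... | suc zero    , refl = aco₁ , aco₁∈ , ∷⁴-⊆ (out⊆ (in⊆in ⊥⊆))
    ... | suc (suc w) , refl = cdx w , cdx∈ w , ∷⁴-⊆ ⊆-refl
    cover (false ∷ false ∷ false ∷ true  ∷ X) eq with ∣p∣≡1⇒p≡⁅x⁆ {p = X} (suc-injective eq)
    ... | zero        , refl = ado₀ , ado₀∈ , ∷⁴-⊆ (in⊆in ⊥⊆)
    ... | suc zero    , refl = bdo₁ , bdo₁∈ , ∷⁴-⊆ (out⊆ (in⊆in ⊥⊆))
    ... | suc (suc w) , refl = cdx w , cdx∈ w , ∷⁴-⊆ ⊆-refl

  length-extend : ∀ es → length (extend es) ≡ length es + (2 * N + 3)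
  length-extend es = begin
    length (stars ++ gadget ++ map lift es)
      ≡⟨ length-++ stars ⟩
    length stars + (7 + length (map lift es))
      ≡⟨ cong₂ (λ x y → x + (7 + y)) length-stars (length-map lift es) ⟩
    (suc m + suc m) + (7 + length es)
      ≡⟨ regroup m (length es) ⟩
    length es + (2 * N + 3) ∎
    where
    open ≡-Reasoning
    regroup : ∀ m l → (suc m + suc m) + (7 + l) ≡ l + (2 * (3 + m) + 3)
    regroup = solve-∀
    length-stars : length stars ≡ suc m + suc m
    length-stars = trans (length-++ (map abx ws))
                         (cong₂ _+_ (trans (length-map abx ws) (length-tabulate id))
                                    (trans (length-map cdx ws) (length-tabulate id)))

  extend-optimal : Optimal N → Optimal (4 + N)
  extend-optimal o = record
    { graph    = mk3 (extend es) (extend-sizes (edges-size graph)) (extend-unique (edges-uniq graph))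
    ; linked   = extend-linked covering linked
    ; covering = extend-covering covering
    ; optimal  = trans (length-extend es) (trans (cong (_+ (2 * N + 3)) optimal) (sym (bound-+4 N)))
    }
    where
    open Optimal o
    es : List (Subset N)
    es = edges graph

optimal : ∀ m → Optimal (3 + m)
optimal 0 = optimal₃
optimal 1 = optimal₄
optimal 2 = optimal₅
optimal 3 = optimal₆
optimal (suc (suc (suc (suc m)))) = Extension.extend-optimal m (optimal m)

construction : ∀ n → Σ (ThreeGraph n) λ H → Connected H × numEdges H ≡ bound n
construction 0 = mk3 [] [] [] , connected-≤2 z≤n _ , refl
construction 1 = mk3 [] [] [] , connected-≤2 (s≤s z≤n) _ , refl
construction 2 = mk3 [] [] [] , connected-≤2 (s≤s (s≤s z≤n)) _ , refl
construction (suc (suc (suc m))) = graph , linked-connected graph linked covering , optimal′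
  where open Optimal (optimal m) renaming (optimal to optimal′)

lemma13 : ((n : ℕ) (H : ThreeGraph n) → Connected H → bound n ≤ numEdges H)
          × ((n : ℕ) → Σ (ThreeGraph n) (λ H → Connected H × numEdges H ≡ bound n))
lemma13 = lower-bound , construction
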